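{- Let $w$ be a finite 2D word over a finite alphabet $\Sigma$. Every 2D palindromic factor of $w$ is an HV-palindrome if and only if $w$ has no factor of the form $$\begin{pmatrix} x & u & y\\ v & p & v^R\\ y & u^R & x\end{pmatrix}$$ where $x,y\in\Sigma$ with $x\neq y$, $u$ is a row (1D word) of some length $k\ge 0$, $v$ is a column of some height $l\ge 0$, and $p$ is a 2D palindrome of size $(l,k)$.
   Context: A 2D word of size $(m,n)$ over $\Sigma$ is an $m\times n$ array $w=[w_{i,j}]$ with entries in $\Sigma$; its rows and columns are 1D words. A factor of $w$ is a sub-array $[w_{i,j}]_{a\le i\le b,\,c\le j\le d}$ of consecutive rows and columns. A 1D word is a palindrome if it equals its reversal. The reverse of a 2D word $w$ of size $(m,n)$ is $w^R=[w_{m-i+1,\,n-j+1}]_{i,j}$ (for a row or column this is the usual reversal), and $w$ is a 2D palindrome if $w=w^R$. $w$ is an HV-palindrome if all its rows and columns are 1D palindromes. In the displayed block array, blocks are placed side by side and on top of each other; when $k=0$ the blocks $u,u^R$ and $p$ are absent, and when $l=0$ the middle block row $(v\ p\ v^R)$ is absent. -}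

module Defs where

open import Data.Nat using (ℕ; zero; suc; _+_; _≤_; _<_)
open import Data.Nat.Properties using (+-monoʳ-<; <-≤-trans)
open import Data.Fin using (Fin; zero; suc; toℕ; fromℕ<; opposite)
open import Data.Fin.Properties using (toℕ<n)
open import Data.Product using (Σ; _×_; _,_)
open import Relation.Binary.PropositionalEquality using (_≡_; _≢_)

Word2D : Set → ℕ → ℕ → Set
Word2D A m n = Fin m → Fin n → A

rev1 : {A : Set} {n : ℕ} → (Fin n → A) → (Fin n → A)
rev1 u j = u (opposite j)

IsPal1 : {A : Set} {n : ℕ} → (Fin n → A) → Set
IsPal1 u = ∀ j → u j ≡ rev1 u j

rev2 : {A : Set} {m n : ℕ} → Word2D A m n → Word2D A m n
rev2 w i j = w (opposite i) (opposite j)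

Is2DPal : {A : Set} {m n : ℕ} → Word2D A m n → Set
Is2DPal w = ∀ i j → w i j ≡ rev2 w i j

IsHVPal : {A : Set} {m n : ℕ} → Word2D A m n → Set
IsHVPal {m = m} {n = n} w =
  ((i : Fin m) → IsPal1 (λ j → w i j)) × ((j : Fin n) → IsPal1 (λ i → w i j))

shift< : ∀ {p m} (a : ℕ) → a + p ≤ m → (r : Fin p) → a + toℕ r < m
shift< a h r = <-≤-trans (+-monoʳ-< a (toℕ<n r)) h

-- sub-array of size (p,q) whose top-left corner is at (a,c) (0-based offsets)
subword : {A : Set} {m n p q : ℕ} → Word2D A m n → (a c : ℕ) →
          a + p ≤ m → c + q ≤ n → Word2D A p q
subword w a c ha hc r s = w (fromℕ< (shift< a ha r)) (fromℕ< (shift< c hc s))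

IsFactor : {A : Set} {m n p q : ℕ} → Word2D A p q → Word2D A m n → Set
IsFactor {m = m} {n} {p} {q} f w =
  Σ ℕ λ a → Σ ℕ λ c → Σ (a + p ≤ m) λ ha → Σ (c + q ≤ n) λ hc →
    ∀ r s → f r s ≡ subword w a c ha hc r s

-- Block position of an index in Fin (2 + l): first, middle (Fin l), last.
data Pos (l : ℕ) : Set where
  first : Pos l
  middle : Fin l → Pos l
  last : Pos l

shiftPos : ∀ {l} → Pos l → Pos (suc l)
shiftPos first = first
shiftPos (middle i) = middle (suc i)
shiftPos last = last

innerPos : ∀ {l} → Fin (suc l) → Pos l
innerPos {zero} zero = last
innerPos {suc l} zero = middle zero
innerPos {suc l} (suc i) = shiftPos (innerPos i)

pos : ∀ {l} → Fin (suc (suc l)) → Pos l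
pos zero = first
pos (suc i) = innerPos i

blockEntry : {A : Set} {k l : ℕ} → A → A → (Fin k → A) → (Fin l → A) →
             Word2D A l k → Pos l → Pos k → A
blockEntry x y u v p first first = x
blockEntry x y u v p first (middle j) = u j
blockEntry x y u v p first last = y
blockEntry x y u v p (middle i) first = v i
blockEntry x y u v p (middle i) (middle j) = p i j
blockEntry x y u v p (middle i) last = rev1 v i
blockEntry x y u v p last first = y
blockEntry x y u v p last (middle j) = rev1 u j
blockEntry x y u v p last last = x

block : {A : Set} {k l : ℕ} → A → A → (Fin k → A) → (Fin l → A) →
        Word2D A l k → Word2D A (suc (suc l)) (suc (suc k))
block x y u v p i j = blockEntry x y u v p (pos i) (pos j)

HasForbiddenFactor : {A : Set} {m n : ℕ} → Word2D A m n → Set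
HasForbiddenFactor {A} w =
  Σ A λ x → Σ A λ y → Σ ℕ λ k → Σ ℕ λ l →
  Σ (Fin k → A) λ u → Σ (Fin l → A) λ v → Σ (Word2D A l k) λ p →
    x ≢ y × Is2DPal p × IsFactor (block x y u v p) w

-- A 2D palindrome f is an HV-palindrome as soon as its rows are palindromes:
-- f i j = f i' j' (primes denoting mirrored indices) turns the palindromicity
-- of every row into that of every column. Suppose a row of a palindromic factor
-- of w is not a palindrome. Peeling off the outer rows keeps a palindromic
-- factor and brings that row to the top or bottom, and the bottom row is the
-- mirror of the top one; peeling off outer columns then brings the mismatch to
-- the two top corners. A 2D palindrome with at least two rows is determined by
-- its top row, left column and interior, so it is the forbidden block with
-- x, y its top corners. Conversely, a forbidden block is a 2D palindrome whose
-- top row is not a palindrome.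
module Submission where

open import Defs
open import Data.Nat using (ℕ; zero; suc; _+_; _≤_; _<_)
open import Data.Nat.Properties using (+-assoc; ≤-refl; ≤-trans; ≤-reflexive; +-monoʳ-≤; n≤1+n)
open import Data.Fin using (Fin; zero; suc; toℕ; fromℕ; fromℕ<; inject₁; opposite; _≟_)
open import Data.Fin.Properties
  using (toℕ-injective; toℕ-fromℕ<; toℕ-inject₁; fromℕ<-toℕ; fromℕ<-cong; opposite-involutive)
open import Data.Product using (_×_; _,_)
open import Data.Empty using (⊥-elim)
open import Relation.Nullary using (¬_)
open import Relation.Nullary.Decidable using (decidable-stable)
open import Relation.Binary.PropositionalEquality

inner : ∀ {l} → Fin l → Fin (suc (suc l))
inner i = suc (inject₁ i)

opposite-fromℕ : ∀ n → opposite (fromℕ n) ≡ zero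
opposite-fromℕ zero = refl
opposite-fromℕ (suc n) = cong inject₁ (opposite-fromℕ n)

opposite-inject₁ : ∀ {n} (i : Fin n) → opposite (inject₁ i) ≡ suc (opposite i)
opposite-inject₁ zero = refl
opposite-inject₁ (suc i) = cong inject₁ (opposite-inject₁ i)

opposite-inner : ∀ {n} (i : Fin n) → opposite (inner i) ≡ inner (opposite i)
opposite-inner i = cong inject₁ (opposite-inject₁ i)

data PosView (l : ℕ) : Fin (suc (suc l)) → Set where
  isFirst : PosView l zero
  isMiddle : (i : Fin l) → PosView l (inner i)
  isLast : PosView l (fromℕ (suc l))

posView : ∀ {l} (i : Fin (suc (suc l))) → PosView l i
posView zero = isFirst
posView {zero} (suc zero) = isLast
posView {suc l} (suc i) with posView i
... | isFirst = isMiddle zero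
... | isMiddle j = isMiddle (suc j)
... | isLast = isLast

pos-inner : ∀ {l} (i : Fin l) → pos (inner i) ≡ middle i
pos-inner {suc l} zero = refl
pos-inner {suc l} (suc i) = cong shiftPos (pos-inner i)

pos-fromℕ : ∀ l → pos (fromℕ (suc l)) ≡ last
pos-fromℕ zero = refl
pos-fromℕ (suc l) = cong shiftPos (pos-fromℕ l)

oppositePos : ∀ {l} → Pos l → Pos l
oppositePos first = last
oppositePos (middle i) = middle (opposite i)
oppositePos last = first

pos-opposite : ∀ {l} (i : Fin (suc (suc l))) → pos (opposite i) ≡ oppositePos (pos i)
pos-opposite {l} i with posView i
... | isFirst = pos-fromℕ l
... | isMiddle j rewrite opposite-inner j | pos-inner j | pos-inner (opposite j) = refl
... | isLast rewrite opposite-fromℕ (suc l) | pos-fromℕ l = refl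

module _ {A : Set} where

  Is2DPal-swapOpposite : ∀ {m n} {f : Word2D A m n} → Is2DPal f →
    ∀ i j → f (opposite i) j ≡ f i (opposite j)
  Is2DPal-swapOpposite {f = f} fp i j =
    trans (fp (opposite i) j) (cong (λ r → f r (opposite j)) (opposite-involutive i))

  Is2DPal-oppositeRow : ∀ {m n} {f : Word2D A m n} → Is2DPal f → ∀ i j →
    f i j ≢ f i (opposite j) →
    f (opposite i) (opposite j) ≢ f (opposite i) (opposite (opposite j))
  Is2DPal-oppositeRow {f = f} fp i j ne e = ne (begin
    f i j                                      ≡⟨ fp i j ⟩
    f (opposite i) (opposite j)                ≡⟨ e ⟩
    f (opposite i) (opposite (opposite j))     ≡⟨ cong (f (opposite i)) (opposite-involutive j) ⟩
    f (opposite i) j                           ≡⟨ Is2DPal-swapOpposite fp i j ⟩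
    f i (opposite j)                           ∎)
    where open ≡-Reasoning

  Is2DPal-rowsPal⇒IsHVPal : ∀ {m n} {f : Word2D A m n} → Is2DPal f →
    (∀ i → IsPal1 (λ j → f i j)) → IsHVPal f
  Is2DPal-rowsPal⇒IsHVPal fp rows =
    rows , λ j i → trans (rows i j) (sym (Is2DPal-swapOpposite fp i j))

  dropRows : ∀ {m n} → Word2D A (suc (suc m)) n → Word2D A m n
  dropRows g i j = g (inner i) j

  dropCols : ∀ {m n} → Word2D A m (suc (suc n)) → Word2D A m n
  dropCols g i j = g i (inner j)

  dropRows-is2DPal : ∀ {m n} {g : Word2D A (suc (suc m)) n} → Is2DPal g → Is2DPal (dropRows g)
  dropRows-is2DPal {g = g} gp i j = trans (gp _ _) (cong (λ r → g r _) (opposite-inner i))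

  dropCols-is2DPal : ∀ {m n} {g : Word2D A m (suc (suc n))} → Is2DPal g → Is2DPal (dropCols g)
  dropCols-is2DPal {g = g} gp i j = trans (gp _ _) (cong (g _) (opposite-inner j))

  IsFactor-trans : ∀ {m n p q r t} {f : Word2D A r t} {g : Word2D A p q} {w : Word2D A m n} →
    IsFactor f g → IsFactor g w → IsFactor f w
  IsFactor-trans {w = w} (a , c , ha , hc , f≡g) (a′ , c′ , ha′ , hc′ , g≡w) =
    a′ + a , c′ + c , offset-≤ ha ha′ , offset-≤ hc hc′ ,
    λ i j → trans (f≡g i j) (trans (g≡w _ _)
      (cong₂ w (fromℕ<-cong _ _ (offset-index a′ ha i) _ _) (fromℕ<-cong _ _ (offset-index c′ hc j) _ _)))
    where
    offset-≤ : ∀ {a a′ p m M} → a + p ≤ m → a′ + m ≤ M → a′ + a + p ≤ M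
    offset-≤ {a} {a′} {p} h h′ = ≤-trans (≤-reflexive (+-assoc a′ a p)) (≤-trans (+-monoʳ-≤ a′ h) h′)
    offset-index : ∀ {a p m} a′ (h : a + p ≤ m) (i : Fin p) →
      a′ + toℕ (fromℕ< (shift< a h i)) ≡ a′ + a + toℕ i
    offset-index {a} a′ h i = trans (cong (a′ +_) (toℕ-fromℕ< _)) (sym (+-assoc a′ a (toℕ i)))

  fromℕ<-suc-toℕ : ∀ {m} (i : Fin m) .(h : suc (toℕ i) < suc (suc m)) → fromℕ< h ≡ inner i
  fromℕ<-suc-toℕ i h = toℕ-injective (trans (toℕ-fromℕ< h) (cong suc (sym (toℕ-inject₁ i))))

  dropRows-isFactor : ∀ {m n} (g : Word2D A (suc (suc m)) n) → IsFactor (dropRows g) g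
  dropRows-isFactor g = 1 , 0 , n≤1+n _ , ≤-refl ,
    λ i j → sym (cong₂ g (fromℕ<-suc-toℕ i (shift< 1 (n≤1+n _) i)) (fromℕ<-toℕ j _))

  dropCols-isFactor : ∀ {m n} (g : Word2D A m (suc (suc n))) → IsFactor (dropCols g) g
  dropCols-isFactor g = 0 , 1 , ≤-refl , n≤1+n _ ,
    λ i j → sym (cong₂ g (fromℕ<-toℕ i _) (fromℕ<-suc-toℕ j (shift< 1 (n≤1+n _) j)))

  blockEntry-opposite : ∀ {k l} (x y : A) (u : Fin k → A) (v : Fin l → A) {p : Word2D A l k} →
    Is2DPal p → ∀ P Q → blockEntry x y u v p P Q ≡ blockEntry x y u v p (oppositePos P) (oppositePos Q)
  blockEntry-opposite x y u v pp first first = refl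
  blockEntry-opposite x y u v pp first (middle j) = cong u (sym (opposite-involutive j))
  blockEntry-opposite x y u v pp first last = refl
  blockEntry-opposite x y u v pp (middle i) first = cong v (sym (opposite-involutive i))
  blockEntry-opposite x y u v pp (middle i) (middle j) = pp i j
  blockEntry-opposite x y u v pp (middle i) last = refl
  blockEntry-opposite x y u v pp last first = refl
  blockEntry-opposite x y u v pp last (middle j) = refl
  blockEntry-opposite x y u v pp last last = refl

  block-is2DPal : ∀ {k l} {x y : A} {u : Fin k → A} {v : Fin l → A} {p : Word2D A l k} →
    Is2DPal p → Is2DPal (block x y u v p)
  block-is2DPal {x = x} {y} {u} {v} pp i j rewrite pos-opposite i | pos-opposite j =
    blockEntry-opposite x y u v pp (pos i) (pos j)

  block-¬IsHVPal : ∀ {k l} {x y : A} {u : Fin k → A} {v : Fin l → A} {p : Word2D A l k} →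
    x ≢ y → ¬ IsHVPal (block x y u v p)
  block-¬IsHVPal {k} {x = x} {y} {u} {v} {p} x≢y (rows , _) =
    x≢y (trans (rows zero zero) (cong (blockEntry x y u v p first) (pos-fromℕ k)))

  Is2DPal⇒block : ∀ {k l} {g : Word2D A (suc (suc l)) (suc (suc k))} → Is2DPal g → ∀ i j →
    g i j ≡ block (g zero zero) (g zero (fromℕ (suc k)))
                  (λ j → g zero (inner j)) (λ i → g (inner i) zero) (dropRows (dropCols g)) i j
  Is2DPal⇒block {k} {l} {g} gp i j with posView i | posView j
  ... | isFirst    | isFirst    = refl
  ... | isFirst    | isMiddle t rewrite pos-inner t = refl
  ... | isFirst    | isLast     rewrite pos-fromℕ k = refl
  ... | isMiddle s | isFirst    rewrite pos-inner s = refl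
  ... | isMiddle s | isMiddle t rewrite pos-inner s | pos-inner t = refl
  ... | isMiddle s | isLast     rewrite pos-inner s | pos-fromℕ k =
    trans (gp _ _) (cong₂ g (opposite-inner s) (opposite-fromℕ (suc k)))
  ... | isLast     | isFirst    rewrite pos-fromℕ l =
    trans (gp _ _) (cong₂ g (opposite-fromℕ (suc l)) refl)
  ... | isLast     | isMiddle t rewrite pos-fromℕ l | pos-inner t =
    trans (gp _ _) (cong₂ g (opposite-fromℕ (suc l)) (opposite-inner t))
  ... | isLast     | isLast     rewrite pos-fromℕ l | pos-fromℕ k =
    trans (gp _ _) (cong₂ g (opposite-fromℕ (suc l)) (opposite-fromℕ (suc k)))

module _ {A : Set} {M N : ℕ} (w : Word2D A M N) where

  cornerMismatch⇒forbidden : ∀ {m k} (f : Word2D A (suc m) (suc (suc k))) →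
    IsFactor f w → Is2DPal f → f zero zero ≢ f zero (fromℕ (suc k)) → HasForbiddenFactor w
  cornerMismatch⇒forbidden {zero} f fw fp ne = ⊥-elim (ne (fp zero zero))
  cornerMismatch⇒forbidden {suc l} {k} f (a , c , ha , hc , f≡w) fp ne =
    _ , _ , k , l , _ , _ , _ , ne , dropRows-is2DPal (dropCols-is2DPal fp) ,
    a , c , ha , hc , λ i j → trans (sym (Is2DPal⇒block fp i j)) (f≡w i j)

  topRowMismatch⇒forbidden : ∀ {m n} (f : Word2D A (suc m) n) → IsFactor f w → Is2DPal f →
    ∀ j → f zero j ≢ f zero (opposite j) → HasForbiddenFactor w
  topRowMismatch⇒forbidden {n = suc zero} f fw fp zero ne = ⊥-elim (ne refl)
  topRowMismatch⇒forbidden {n = suc (suc n)} f fw fp j ne with posView j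
  ... | isFirst = cornerMismatch⇒forbidden f fw fp ne
  ... | isLast = cornerMismatch⇒forbidden f fw fp
    λ e → ne (trans (sym e) (cong (f zero) (sym (opposite-fromℕ (suc n)))))
  ... | isMiddle t = topRowMismatch⇒forbidden (dropCols f)
    (IsFactor-trans {w = w} (dropCols-isFactor f) fw) (dropCols-is2DPal fp) t
    λ e → ne (trans e (cong (f zero) (sym (opposite-inner t))))

  rowMismatch⇒forbidden : ∀ {m n} (f : Word2D A m n) → IsFactor f w → Is2DPal f →
    ∀ i j → f i j ≢ f i (opposite j) → HasForbiddenFactor w
  rowMismatch⇒forbidden {suc zero} f fw fp zero j ne = topRowMismatch⇒forbidden f fw fp j ne
  rowMismatch⇒forbidden {suc (suc m)} f fw fp i j ne with posView i
  ... | isFirst = topRowMismatch⇒forbidden f fw fp j ne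
  ... | isLast = topRowMismatch⇒forbidden f fw fp (opposite j)
    (subst (λ r → f r (opposite j) ≢ f r (opposite (opposite j)))
           (opposite-fromℕ (suc m)) (Is2DPal-oppositeRow fp _ j ne))
  ... | isMiddle t = rowMismatch⇒forbidden (dropRows f)
    (IsFactor-trans {w = w} (dropRows-isFactor f) fw) (dropRows-is2DPal fp) t j ne

theorem3p5 : {s m n : ℕ} (w : Word2D (Fin s) m n) →
    ((∀ {p q : ℕ} (f : Word2D (Fin s) (suc p) (suc q)) →
        IsFactor f w → Is2DPal f → IsHVPal f) → ¬ HasForbiddenFactor w)
    × (¬ HasForbiddenFactor w →
        ∀ {p q : ℕ} (f : Word2D (Fin s) (suc p) (suc q)) →
          IsFactor f w → Is2DPal f → IsHVPal f)
theorem3p5 w =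
  (λ palFactorsHV (x , y , k , l , u , v , p , x≢y , pp , fw) →
     block-¬IsHVPal x≢y (palFactorsHV (block x y u v p) fw (block-is2DPal pp))) ,
  (λ noForbidden f fw fp → Is2DPal-rowsPal⇒IsHVPal fp λ i j →
     decidable-stable (f i j ≟ f i (opposite j))
       λ ne → noForbidden (rowMismatch⇒forbidden w f fw fp i j ne))
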